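{- Let $n > 1$ be a positive integer with prime factorization $n = \prod_{i=1}^{\ell} p_i^{a_i}$, where $p_1 < p_2 < \cdots < p_{\ell}$ are primes, each $a_i \geq 1$, and $a_{\ell} = 1$. Suppose that \[ p_i - 1 = \prod_{j=1}^{i-1} p_j^{a_j} \quad \text{for } 1 \leq i < \ell \] (empty product equal to $1$) and that $p_{\ell} + 1 = \frac{n}{p_{\ell}}$. Then $n$ is a prime power Giuga number.
   Context: A prime power Giuga number is a composite positive integer $n > 1$ such that \[ \sum_{p^k \mid n} \frac{1}{p^k} - \frac{1}{n} \in \mathbb{N}, \] where the sum is taken over all prime powers $p^k$ ($p$ prime, $k \geq 1$) dividing $n$. -}

module Defs where

open import Data.Bool using (Bool; true; false; _∧_; if_then_else_)
open import Data.Nat as ℕ using (ℕ; zero; suc; _^_; _≡ᵇ_)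
open import Data.Nat.Divisibility using (_∣?_)
open import Data.Nat.Primality using (Prime; Composite; prime?)
open import Data.List using (List; upTo; map; foldr)
open import Data.Bool.ListAction using (any)
open import Data.Integer using (+_)
open import Data.Rational using (ℚ; _/_; _+_; _-_; 0ℚ)
open import Data.Product using (Σ; _×_)
open import Relation.Nullary using (does)
open import Relation.Binary.PropositionalEquality using (_≡_)

-- 1/d as a rational (with the junk value 1/0 := 0, never used below)
recip : ℕ → ℚ
recip zero    = 0ℚ
recip (suc k) = (+ 1) / suc k

-- Boolean test: d is a prime power p^k with p prime and k ≥ 1.
-- (If d = p^(k+1) then p ≤ d and k < d, so the search is exhaustive.)
isPrimePowerᵇ : ℕ → Bool
isPrimePowerᵇ d =
  any (λ p → does (prime? p) ∧ any (λ k → (p ^ suc k) ≡ᵇ d) (upTo d)) (upTo (suc d))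

-- Σ_{p^k ∣ n} 1/p^k : sum over all prime powers d = p^k (k ≥ 1) dividing n.
-- Every such d satisfies 1 ≤ d ≤ n (for n ≥ 1), so we range over d = 1, …, n.
primePowerRecipSum : ℕ → ℚ
primePowerRecipSum n =
  foldr _+_ 0ℚ
    (map (λ j → if isPrimePowerᵇ (suc j) ∧ does (suc j ∣? n) then recip (suc j) else 0ℚ)
         (upTo n))

PrimePowerGiuga : ℕ → Set
PrimePowerGiuga n =
  Composite n × Σ ℕ (λ m → primePowerRecipSum n - recip n ≡ (+ m) / 1)

module Submission where

-- Index the primes from 0 to m = ℓ - 1 and write Qᵢ = p₀^a₀ ⋯ pᵢ₋₁^aᵢ₋₁, so that the
-- hypotheses say pᵢ = Qᵢ + 1 for i < m and n = Qₘ pₘ with Qₘ = pₘ + 1. The prime powers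
-- dividing n are exactly the pᵢ^(k+1) with k < aᵢ, so the sum splits into geometric blocks,
-- and since 1/P = 1/(P+1) + 1/(P(P+1)), the block of pᵢ = Qᵢ + 1 telescopes to 1/Qᵢ - 1/Qᵢ₊₁.
-- The blocks below m therefore add up to 1 - 1/Qₘ, and the same identity with P = pₘ gives
--   1 - 1/(pₘ+1) + 1/pₘ - 1/((pₘ+1)pₘ) = 1.

module Sums where

  open import Data.Bool using (Bool; true; false; T; T?; if_then_else_)
  open import Data.Empty using (⊥-elim)
  import Data.Integer as ℤ
  open import Data.List using ([]; _∷_; applyUpTo; foldr)
  open import Data.Nat as ℕ using (ℕ; zero; suc; NonZero; _<_; _≤_; z<s; s<s)
  import Data.Nat.Properties as ℕₚ
  import Data.Nat.Tactic.RingSolver as ℕ-Solver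
  open import Data.Product using (_×_; _,_; proj₁; proj₂; ∃₂)
  open import Data.Rational using (ℚ; 0ℚ; 1ℚ; _+_; _-_; _*_; toℚᵘ)
  open import Data.Rational.Properties
    using (toℚᵘ-injective; toℚᵘ-homo-+; toℚᵘ-homo-*; toℚᵘ-fromℚᵘ;
           +-identityˡ; +-identityʳ; +-inverseʳ; +-assoc; *-distribʳ-+)
  open import Data.Rational.Solver using (module +-*-Solver)
  import Data.Rational.Unnormalised as ℚᵘ
  import Data.Rational.Unnormalised.Properties as ℚᵘₚ
  open import Function using (_∘_)
  open import Relation.Binary.PropositionalEquality
    using (_≡_; _≢_; refl; sym; trans; cong; cong₂; subst; module ≡-Reasoning)
  open import Relation.Nullary using (¬_; yes; no)
  open import Defs using (recip)

  toℚᵘ-recip : ∀ k → toℚᵘ (recip (suc k)) ℚᵘ.≃ ℚᵘ.mkℚᵘ (ℤ.+ 1) k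
  toℚᵘ-recip k = toℚᵘ-fromℚᵘ (ℚᵘ.mkℚᵘ (ℤ.+ 1) k)

  recip-* : ∀ m n .{{_ : NonZero m}} .{{_ : NonZero n}} → recip (m ℕ.* n) ≡ recip m * recip n
  recip-* (suc a) (suc b) = toℚᵘ-injective (begin
    toℚᵘ (recip (suc a ℕ.* suc b))                   ≈⟨ toℚᵘ-recip (b ℕ.+ a ℕ.* suc b) ⟩
    ℚᵘ.mkℚᵘ (ℤ.+ 1) (b ℕ.+ a ℕ.* suc b)               ≈⟨ ℚᵘ.*≡* (cong ℤ.+_ (ℕ-Solver.solve (a ∷ b ∷ []))) ⟩
    ℚᵘ.mkℚᵘ (ℤ.+ 1) a ℚᵘ.* ℚᵘ.mkℚᵘ (ℤ.+ 1) b          ≈⟨ ℚᵘₚ.*-cong (toℚᵘ-recip a) (toℚᵘ-recip b) ⟨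
    toℚᵘ (recip (suc a)) ℚᵘ.* toℚᵘ (recip (suc b))   ≈⟨ toℚᵘ-homo-* (recip (suc a)) (recip (suc b)) ⟨
    toℚᵘ (recip (suc a) * recip (suc b))             ∎)
    where open ℚᵘₚ.≃-Reasoning

  recip-split : ∀ P .{{_ : NonZero P}} → recip P ≡ recip (suc P) + recip (P ℕ.* suc P)
  recip-split (suc P) = toℚᵘ-injective (begin
    toℚᵘ (recip (suc P))                                  ≈⟨ toℚᵘ-recip P ⟩
    ℚᵘ.mkℚᵘ (ℤ.+ 1) P                                      ≈⟨ ℚᵘ.*≡* (cong ℤ.+_ (ℕ-Solver.solve (P ∷ []))) ⟩
    ℚᵘ.mkℚᵘ (ℤ.+ 1) (suc P) ℚᵘ.+ ℚᵘ.mkℚᵘ (ℤ.+ 1) Q          ≈⟨ ℚᵘₚ.+-cong (toℚᵘ-recip (suc P)) (toℚᵘ-recip Q) ⟨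
    toℚᵘ (recip (suc (suc P))) ℚᵘ.+ toℚᵘ (recip (suc Q))  ≈⟨ toℚᵘ-homo-+ (recip (suc (suc P))) (recip (suc Q)) ⟨
    toℚᵘ (recip (suc (suc P)) + recip (suc Q))            ∎)
    where
    open ℚᵘₚ.≃-Reasoning
    Q = suc P ℕ.+ P ℕ.* suc (suc P)

  recip-split-* : ∀ P x .{{_ : NonZero P}} .{{_ : NonZero x}} →
                  recip (suc P ℕ.* x) ≡ recip (P ℕ.* x) - recip (P ℕ.* (suc P ℕ.* x))
  recip-split-* P x = begin
    recip (suc P ℕ.* x)
      ≡⟨ solve 2 (λ b c → b := (b :+ c) :- c) refl (recip (suc P ℕ.* x)) (recip (P ℕ.* suc P ℕ.* x)) ⟩
    recip (suc P ℕ.* x) + recip (P ℕ.* suc P ℕ.* x) - recip (P ℕ.* suc P ℕ.* x)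
      ≡⟨ cong₂ (λ u v → u + v - recip (P ℕ.* suc P ℕ.* x)) (recip-* (suc P) x) (recip-* (P ℕ.* suc P) x) ⟩
    recip (suc P) * recip x + recip (P ℕ.* suc P) * recip x - recip (P ℕ.* suc P ℕ.* x)
      ≡⟨ cong (_- recip (P ℕ.* suc P ℕ.* x)) (*-distribʳ-+ (recip x) (recip (suc P)) (recip (P ℕ.* suc P))) ⟨
    (recip (suc P) + recip (P ℕ.* suc P)) * recip x - recip (P ℕ.* suc P ℕ.* x)
      ≡⟨ cong₂ (λ u v → u * recip x - recip v) (sym (recip-split P)) (ℕₚ.*-assoc P (suc P) x) ⟩
    recip P * recip x - recip (P ℕ.* (suc P ℕ.* x))
      ≡⟨ cong (_- recip (P ℕ.* (suc P ℕ.* x))) (recip-* P x) ⟨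
    recip (P ℕ.* x) - recip (P ℕ.* (suc P ℕ.* x))
      ∎
    where
    open ≡-Reasoning
    open +-*-Solver
    instance
      _ : NonZero (P ℕ.* suc P)
      _ = ℕₚ.m*n≢0 P (suc P)

  giuga-identity : ∀ P .{{_ : NonZero P}} → 1ℚ - recip (suc P) + recip P - recip (suc P ℕ.* P) ≡ 1ℚ
  giuga-identity P = begin
    1ℚ - recip (suc P) + recip P - recip (suc P ℕ.* P)
      ≡⟨ cong₂ (λ u v → 1ℚ - recip (suc P) + u - recip v) (recip-split P) (ℕₚ.*-comm (suc P) P) ⟩
    1ℚ - recip (suc P) + (recip (suc P) + recip (P ℕ.* suc P)) - recip (P ℕ.* suc P)
      ≡⟨ solve 2 (λ x y → con 1ℚ :- x :+ (x :+ y) :- y := con 1ℚ) refl (recip (suc P)) (recip (P ℕ.* suc P)) ⟩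
    1ℚ
      ∎
    where
    open ≡-Reasoning
    open +-*-Solver

  ∑ : ℕ → (ℕ → ℚ) → ℚ
  ∑ n f = foldr _+_ 0ℚ (applyUpTo f n)

  ∑-cong : ∀ n {f g : ℕ → ℚ} → (∀ {i} → i < n → f i ≡ g i) → ∑ n f ≡ ∑ n g
  ∑-cong zero    f≗g = refl
  ∑-cong (suc n) f≗g = cong₂ _+_ (f≗g z<s) (∑-cong n (f≗g ∘ s<s))

  ∑-zero : ∀ n {f : ℕ → ℚ} → (∀ {i} → i < n → f i ≡ 0ℚ) → ∑ n f ≡ 0ℚ
  ∑-zero zero    f≗0 = refl
  ∑-zero (suc n) f≗0 = cong₂ _+_ (f≗0 z<s) (∑-zero n (f≗0 ∘ s<s))

  ∑-single : ∀ n {f : ℕ → ℚ} {c} → c < n → (∀ {i} → i < n → i ≢ c → f i ≡ 0ℚ) → ∑ n f ≡ f c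
  ∑-single (suc n) {f} {zero} _ f≗0 = begin
    f 0 + ∑ n (f ∘ suc)  ≡⟨ cong (f 0 +_) (∑-zero n λ i<n → f≗0 (s<s i<n) λ ()) ⟩
    f 0 + 0ℚ             ≡⟨ +-identityʳ (f 0) ⟩
    f 0                  ∎
    where open ≡-Reasoning
  ∑-single (suc n) {f} {suc c} (s<s c<n) f≗0 = begin
    f 0 + ∑ n (f ∘ suc)  ≡⟨ cong₂ _+_ (f≗0 z<s λ ()) (∑-single n c<n λ i<n i≢c → f≗0 (s<s i<n) (i≢c ∘ ℕₚ.suc-injective)) ⟩
    0ℚ + f (suc c)       ≡⟨ +-identityˡ (f (suc c)) ⟩
    f (suc c)            ∎
    where open ≡-Reasoning

  ∑-distrib-+ : ∀ n (f g : ℕ → ℚ) → ∑ n (λ i → f i + g i) ≡ ∑ n f + ∑ n g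
  ∑-distrib-+ zero    f g = refl
  ∑-distrib-+ (suc n) f g = begin
    (f 0 + g 0) + ∑ n (λ i → f (suc i) + g (suc i)) ≡⟨ cong ((f 0 + g 0) +_) (∑-distrib-+ n (f ∘ suc) (g ∘ suc)) ⟩
    (f 0 + g 0) + (∑ n (f ∘ suc) + ∑ n (g ∘ suc))   ≡⟨ solve 4 (λ a b c d → (a :+ b) :+ (c :+ d) := (a :+ c) :+ (b :+ d))
                                                          refl (f 0) (g 0) (∑ n (f ∘ suc)) (∑ n (g ∘ suc)) ⟩
    (f 0 + ∑ n (f ∘ suc)) + (g 0 + ∑ n (g ∘ suc))   ∎
    where
    open ≡-Reasoning
    open +-*-Solver

  ∑-comm : ∀ m n (F : ℕ → ℕ → ℚ) → ∑ m (λ i → ∑ n (F i)) ≡ ∑ n (λ j → ∑ m (λ i → F i j))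
  ∑-comm zero    n F = sym (∑-zero n λ _ → refl)
  ∑-comm (suc m) n F = begin
    ∑ n (F 0) + ∑ m (λ i → ∑ n (F (suc i)))         ≡⟨ cong (∑ n (F 0) +_) (∑-comm m n (F ∘ suc)) ⟩
    ∑ n (F 0) + ∑ n (λ j → ∑ m (λ i → F (suc i) j)) ≡⟨ ∑-distrib-+ n (F 0) (λ j → ∑ m (λ i → F (suc i) j)) ⟨
    ∑ n (λ j → ∑ (suc m) (λ i → F i j))             ∎
    where open ≡-Reasoning

  ∑-snoc : ∀ n (f : ℕ → ℚ) → ∑ (suc n) f ≡ ∑ n f + f n
  ∑-snoc zero    f = trans (+-identityʳ (f 0)) (sym (+-identityˡ (f 0)))
  ∑-snoc (suc n) f = trans (cong (f 0 +_) (∑-snoc n (f ∘ suc))) (sym (+-assoc (f 0) (∑ n (f ∘ suc)) (f (suc n))))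

  ∑-telescope : ∀ n (g : ℕ → ℚ) → ∑ n (λ i → g i - g (suc i)) ≡ g 0 - g n
  ∑-telescope zero    g = sym (+-inverseʳ (g 0))
  ∑-telescope (suc n) g = begin
    (g 0 - g 1) + ∑ n (λ i → g (suc i) - g (suc (suc i))) ≡⟨ cong ((g 0 - g 1) +_) (∑-telescope n (g ∘ suc)) ⟩
    (g 0 - g 1) + (g 1 - g (suc n))                       ≡⟨ solve 3 (λ a b c → (a :- b) :+ (b :- c) := a :- c)
                                                                refl (g 0) (g 1) (g (suc n)) ⟩
    g 0 - g (suc n)                                       ∎
    where
    open ≡-Reasoning
    open +-*-Solver

  ∑-geometric : ∀ P .{{_ : NonZero P}} a →
                ∑ a (λ k → recip (suc P ℕ.^ suc k)) ≡ recip P - recip (P ℕ.* suc P ℕ.^ a)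
  ∑-geometric P {{P≢0}} a = begin
    ∑ a (λ k → recip (suc P ℕ.^ suc k))
      ≡⟨ ∑-cong a (λ {k} _ → recip-split-* P (suc P ℕ.^ k) {{P≢0}} {{ℕₚ.m^n≢0 (suc P) k}}) ⟩
    ∑ a (λ k → recip (P ℕ.* suc P ℕ.^ k) - recip (P ℕ.* suc P ℕ.^ suc k))
      ≡⟨ ∑-telescope a (λ k → recip (P ℕ.* suc P ℕ.^ k)) ⟩
    recip (P ℕ.* 1) - recip (P ℕ.* suc P ℕ.^ a)
      ≡⟨ cong (λ u → recip u - recip (P ℕ.* suc P ℕ.^ a)) (ℕₚ.*-identityʳ P) ⟩
    recip P - recip (P ℕ.* suc P ℕ.^ a)
      ∎
    where open ≡-Reasoning

  if-T : ∀ {A : Set} b {x y : A} → T b → (if b then x else y) ≡ x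
  if-T true _ = refl

  if-¬T : ∀ {A : Set} b {x y : A} → ¬ T b → (if b then x else y) ≡ y
  if-¬T false _  = refl
  if-¬T true  ¬t = ⊥-elim (¬t _)

  ∑-indicator : ∀ n (f : ℕ → ℚ) {x} → 0 < x → x ≤ n →
                ∑ n (λ j → if x ℕ.≡ᵇ suc j then f (suc j) else 0ℚ) ≡ f x
  ∑-indicator n f {suc w} _ w<n = trans
    (∑-single n w<n λ _ j≢w → if-¬T (w ℕ.≡ᵇ _) (j≢w ∘ sym ∘ ℕₚ.≡ᵇ⇒≡ w _))
    (if-T (w ℕ.≡ᵇ w) (ℕₚ.≡⇒≡ᵇ w w refl))

  module _ (L : ℕ) (e : ℕ → ℕ) (v : ℕ → ℕ → ℕ) (c : ℕ → Bool)
    (v-injective : ∀ {i k i′ k′} → i < L → k < e i → i′ < L → k′ < e i′ → v i k ≡ v i′ k′ → i ≡ i′ × k ≡ k′)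
    (v-satisfies : ∀ {i k} → i < L → k < e i → T (c (v i k)))
    (v-surjective : ∀ d → T (c d) → ∃₂ λ i k → i < L × k < e i × v i k ≡ d)
    (f : ℕ → ℚ) where

    private
      δ : ℕ → ℕ → ℕ → ℚ
      δ i k d = if v i k ℕ.≡ᵇ d then f d else 0ℚ

      indicator≡∑∑δ : ∀ d → (if c d then f d else 0ℚ) ≡ ∑ L (λ i → ∑ (e i) (λ k → δ i k d))
      indicator≡∑∑δ d with T? (c d)
      ... | no ¬cd = trans (if-¬T (c d) ¬cd) (sym (∑-zero L λ i<L → ∑-zero _ λ k<e →
              if-¬T (v _ _ ℕ.≡ᵇ d) λ v≡ᵇd → ¬cd (subst (T ∘ c) (ℕₚ.≡ᵇ⇒≡ _ d v≡ᵇd) (v-satisfies i<L k<e))))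
      ... | yes cd with v-surjective d cd
      ... | i₀ , k₀ , i₀<L , k₀<e , v₀≡d = trans (if-T (c d) cd) (sym (begin
        ∑ L (λ i → ∑ (e i) (λ k → δ i k d))  ≡⟨ ∑-single L i₀<L (λ i<L i≢i₀ → ∑-zero _ λ k<e →
                                                    if-¬T (v _ _ ℕ.≡ᵇ d) (i≢i₀ ∘ proj₁ ∘ same-as-v₀ i<L k<e)) ⟩
        ∑ (e i₀) (λ k → δ i₀ k d)           ≡⟨ ∑-single (e i₀) k₀<e (λ k<e k≢k₀ →
                                                    if-¬T (v i₀ _ ℕ.≡ᵇ d) (k≢k₀ ∘ proj₂ ∘ same-as-v₀ i₀<L k<e)) ⟩
        δ i₀ k₀ d                           ≡⟨ if-T (v i₀ k₀ ℕ.≡ᵇ d) (ℕₚ.≡⇒≡ᵇ _ d v₀≡d) ⟩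
        f d                                 ∎))
        where
        open ≡-Reasoning
        same-as-v₀ : ∀ {i k} → i < L → k < e i → T (v i k ℕ.≡ᵇ d) → i ≡ i₀ × k ≡ k₀
        same-as-v₀ i<L k<e v≡ᵇd = v-injective i<L k<e i₀<L k₀<e (trans (ℕₚ.≡ᵇ⇒≡ _ d v≡ᵇd) (sym v₀≡d))

    ∑-reindex : ∀ n → (∀ {i k} → i < L → k < e i → 0 < v i k × v i k ≤ n) →
                ∑ n (λ j → if c (suc j) then f (suc j) else 0ℚ) ≡ ∑ L (λ i → ∑ (e i) (λ k → f (v i k)))
    ∑-reindex n v-range = begin
      ∑ n (λ j → if c (suc j) then f (suc j) else 0ℚ)
        ≡⟨ ∑-cong n (λ {j} _ → indicator≡∑∑δ (suc j)) ⟩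
      ∑ n (λ j → ∑ L (λ i → ∑ (e i) (λ k → δ i k (suc j))))
        ≡⟨ ∑-comm n L _ ⟩
      ∑ L (λ i → ∑ n (λ j → ∑ (e i) (λ k → δ i k (suc j))))
        ≡⟨ ∑-cong L (λ {i} _ → ∑-comm n (e i) _) ⟩
      ∑ L (λ i → ∑ (e i) (λ k → ∑ n (λ j → δ i k (suc j))))
        ≡⟨ ∑-cong L (λ i<L → ∑-cong _ λ k<e → ∑-indicator n f (proj₁ (v-range i<L k<e)) (proj₂ (v-range i<L k<e))) ⟩
      ∑ L (λ i → ∑ (e i) (λ k → f (v i k)))
        ∎
      where open ≡-Reasoning

module PrimePowers where

  open import Data.Bool using (T; _∧_)
  open import Data.Bool.ListAction using (any)
  open import Data.Bool.Properties using (T-∧)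
  open import Data.Empty using (⊥-elim)
  open import Data.List using ([]; _∷_; [_]; _++_; applyUpTo; upTo)
  open import Data.List.Membership.Propositional using (lose)
  open import Data.List.Membership.Propositional.Properties using (∈-applyUpTo⁺; ∈-upTo⁺)
  open import Data.List.Properties using (applyUpTo-∷ʳ)
  open import Data.List.Relation.Unary.All.Properties using (applyUpTo⁺₁)
  open import Data.List.Relation.Unary.Any using (satisfied)
  open import Data.List.Relation.Unary.Any.Properties using (any⁺; any⁻)
  open import Data.Nat as ℕ using (ℕ; zero; suc; NonZero; _<_; _≤_; _∸_; _+_; _*_; _^_; s≤s; z<s; s<s)
  open import Data.Nat.Divisibility
  open import Data.Nat.ListAction using (product)
  open import Data.Nat.ListAction.Properties using (∈⇒∣product; product≢0; product-++)
  open import Data.Nat.Primality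
  import Data.Nat.Properties as ℕₚ
  import Data.Nat.Tactic.RingSolver as ℕ-Solver
  open import Data.Product using (_×_; _,_; ∃; ∃₂)
  open import Data.Sum using (inj₁; inj₂)
  open import Function using (_∘_)
  open import Function.Bundles using (Equivalence)
  open import Relation.Binary.Definitions using (tri<; tri≈; tri>)
  open import Relation.Binary.PropositionalEquality
    using (_≡_; refl; sym; trans; cong; subst; module ≡-Reasoning)
  open import Relation.Nullary using (¬_; Dec; does; yes; no)
  open import Defs using (isPrimePowerᵇ)

  ∏ : ℕ → (ℕ → ℕ) → ℕ
  ∏ n f = product (applyUpTo f n)

  f∣∏ : ∀ {n} (f : ℕ → ℕ) {i} → i < n → f i ∣ ∏ n f
  f∣∏ f i<n = ∈⇒∣product (∈-applyUpTo⁺ f i<n)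

  ∏-snoc : ∀ n (f : ℕ → ℕ) → ∏ (suc n) f ≡ ∏ n f * f n
  ∏-snoc n f = begin
    product (applyUpTo f (suc n))      ≡⟨ cong product (applyUpTo-∷ʳ f n) ⟨
    product (applyUpTo f n ++ [ f n ])  ≡⟨ product-++ (applyUpTo f n) [ f n ] ⟩
    ∏ n f * (f n * 1)                   ≡⟨ cong (∏ n f *_) (ℕₚ.*-identityʳ (f n)) ⟩
    ∏ n f * f n                         ∎
    where open ≡-Reasoning

  ∏-nonZero : ∀ n {f : ℕ → ℕ} → (∀ {i} → i < n → NonZero (f i)) → NonZero (∏ n f)
  ∏-nonZero n {f} f≢0 = product≢0 (applyUpTo⁺₁ f n f≢0)

  increasing⇒injective : ∀ L {f : ℕ → ℕ} → (∀ {i j} → j < L → i < j → f i < f j) →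
                         ∀ {i j} → i < L → j < L → f i ≡ f j → i ≡ j
  increasing⇒injective L f-inc {i} {j} i<L j<L fi≡fj with ℕₚ.<-cmp i j
  ... | tri< i<j _ _ = ⊥-elim (ℕₚ.<⇒≢ (f-inc j<L i<j) fi≡fj)
  ... | tri≈ _ i≡j _ = i≡j
  ... | tri> _ _ j<i = ⊥-elim (ℕₚ.<⇒≢ (f-inc i<L j<i) (sym fi≡fj))

  ^-cancelʳ-≤ : ∀ {m x y} → 1 < m → m ^ x ≤ m ^ y → x ≤ y
  ^-cancelʳ-≤ {m} 1<m mˣ≤mʸ = ℕₚ.≮⇒≥ λ y<x → ℕₚ.<⇒≱ (ℕₚ.^-monoʳ-< m 1<m y<x) mˣ≤mʸ

  ^-injectiveʳ : ∀ {m x y} → 1 < m → m ^ x ≡ m ^ y → x ≡ y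
  ^-injectiveʳ 1<m eq = ℕₚ.≤-antisym (^-cancelʳ-≤ 1<m (ℕₚ.≤-reflexive eq)) (^-cancelʳ-≤ 1<m (ℕₚ.≤-reflexive (sym eq)))

  n<m^n : ∀ {m} → 1 < m → ∀ n → n < m ^ n
  n<m^n 1<m zero        = z<s
  n<m^n {m} 1<m (suc n) = ℕₚ.≤-<-trans (n<m^n 1<m n) (begin-strict
    m ^ n      <⟨ ℕₚ.m<m*n (m ^ n) m 1<m ⟩
    m ^ n * m  ≡⟨ ℕₚ.*-comm (m ^ n) m ⟩
    m * m ^ n  ∎)
    where
    open ℕₚ.≤-Reasoning
    instance
      _ : NonZero (m ^ n)
      _ = ℕₚ.m^n≢0 m n {{ℕ.>-nonZero (ℕₚ.<-trans z<s 1<m)}}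

  ^-monoʳ-∣ : ∀ m {x y} → x ≤ y → m ^ x ∣ m ^ y
  ^-monoʳ-∣ m {x} {y} x≤y = divides (m ^ (y ∸ x)) (begin
    m ^ y                ≡⟨ cong (m ^_) (ℕₚ.m+[n∸m]≡n x≤y) ⟨
    m ^ (x + (y ∸ x))     ≡⟨ ℕₚ.^-distribˡ-+-* m x (y ∸ x) ⟩
    m ^ x * m ^ (y ∸ x)   ≡⟨ ℕₚ.*-comm (m ^ x) (m ^ (y ∸ x)) ⟩
    m ^ (y ∸ x) * m ^ x   ∎)
    where open ≡-Reasoning

  prime⇒1< : ∀ {p} → Prime p → 1 < p
  prime⇒1< {p} p-prime = ℕ.nonTrivial⇒n>1 p {{prime⇒nonTrivial p-prime}}

  prime∣^⇒∣ : ∀ {p b} → Prime p → ∀ e → p ∣ b ^ e → p ∣ b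
  prime∣^⇒∣ p-prime zero p∣1 = ⊥-elim (ℕₚ.<⇒≢ (prime⇒1< p-prime) (sym (∣1⇒≡1 p∣1)))
  prime∣^⇒∣ {b = b} p-prime (suc e) p∣bᵉ⁺¹ with euclidsLemma b (b ^ e) p-prime p∣bᵉ⁺¹
  ... | inj₁ p∣b  = p∣b
  ... | inj₂ p∣bᵉ = prime∣^⇒∣ p-prime e p∣bᵉ

  prime∣prime⇒≡ : ∀ {p q} → Prime p → Prime q → p ∣ q → p ≡ q
  prime∣prime⇒≡ p-prime q-prime p∣q with prime⇒irreducible q-prime p∣q
  ... | inj₁ p≡1 = ⊥-elim (ℕₚ.<⇒≢ (prime⇒1< p-prime) (sym p≡1))
  ... | inj₂ p≡q = p≡q

  prime^∣*-cancelʳ : ∀ {p a b} → Prime p → ¬ p ∣ b → ∀ e → p ^ e ∣ a * b → p ^ e ∣ a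
  prime^∣*-cancelʳ p-prime p∤b zero _ = 1∣ _
  prime^∣*-cancelʳ {p} {a} {b} p-prime p∤b (suc e) pᵉ⁺¹∣ab
    with euclidsLemma a b p-prime (∣-trans (m∣m*n (p ^ e)) pᵉ⁺¹∣ab)
  ... | inj₂ p∣b = ⊥-elim (p∤b p∣b)
  ... | inj₁ (divides a′ refl) =
    subst (p * p ^ e ∣_) (ℕₚ.*-comm p a′) (*-monoʳ-∣ p (prime^∣*-cancelʳ p-prime p∤b e pᵉ∣a′b))
    where
    instance _ = prime⇒nonZero p-prime
    reassoc : a′ * p * b ≡ p * (a′ * b)
    reassoc = ℕ-Solver.solve (a′ ∷ p ∷ b ∷ [])
    pᵉ∣a′b : p ^ e ∣ a′ * b
    pᵉ∣a′b = *-cancelˡ-∣ p (subst (p * p ^ e ∣_) reassoc pᵉ⁺¹∣ab)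

  prime^∣∏^⇒factor : ∀ L {p e : ℕ → ℕ} → (∀ {i} → i < L → Prime (p i)) →
              (∀ {i j} → i < L → j < L → p i ≡ p j → i ≡ j) →
              ∀ {q k} → Prime q → q ^ suc k ∣ ∏ L (λ i → p i ^ e i) →
              ∃ λ i → i < L × q ≡ p i × k < e i
  prime^∣∏^⇒factor zero p-prime p-inj {q} {k} q-prime qᵏ⁺¹∣1 =
    ⊥-elim (ℕₚ.<⇒≢ (prime⇒1< q-prime) (sym (∣1⇒≡1 (∣-trans (m∣m*n (q ^ k)) qᵏ⁺¹∣1))))
  prime^∣∏^⇒factor (suc L) {p} {e} p-prime p-inj {q} {k} q-prime qᵏ⁺¹∣∏ with q ℕₚ.≟ p 0
  ... | yes refl = 0 , z<s , refl , ^-cancelʳ-≤ (prime⇒1< q-prime)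
                                      (∣⇒≤ {{ℕₚ.m^n≢0 q (e 0) {{prime⇒nonZero q-prime}}}}
                                        (prime^∣*-cancelʳ q-prime q∤rest (suc k) qᵏ⁺¹∣∏))
    where
    q∤rest : ¬ q ∣ ∏ L (λ i → p (suc i) ^ e (suc i))
    q∤rest q∣rest with prime^∣∏^⇒factor L {p ∘ suc} {e ∘ suc} (p-prime ∘ s<s)
                         (λ i<L j<L → ℕₚ.suc-injective ∘ p-inj (s<s i<L) (s<s j<L))
                         {k = 0} q-prime (subst (_∣ ∏ L (λ i → p (suc i) ^ e (suc i))) (sym (ℕₚ.*-identityʳ q)) q∣rest)
    ... | i , i<L , q≡pᵢ₊₁ , _ with p-inj z<s (s<s i<L) q≡pᵢ₊₁
    ... | ()
  ... | no q≢p₀ with prime^∣∏^⇒factor L {p ∘ suc} {e ∘ suc} (p-prime ∘ s<s)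
                       (λ i<L j<L → ℕₚ.suc-injective ∘ p-inj (s<s i<L) (s<s j<L))
                       q-prime (prime^∣*-cancelʳ q-prime q∤p₀ᵉ⁰ (suc k)
                                  (subst (q ^ suc k ∣_) (ℕₚ.*-comm (p 0 ^ e 0) _) qᵏ⁺¹∣∏))
    where
    q∤p₀ᵉ⁰ : ¬ q ∣ p 0 ^ e 0
    q∤p₀ᵉ⁰ = q≢p₀ ∘ prime∣prime⇒≡ q-prime (p-prime z<s) ∘ prime∣^⇒∣ q-prime (e 0)
  ... | i , i<L , q≡pᵢ₊₁ , k<eᵢ₊₁ = suc i , s<s i<L , q≡pᵢ₊₁ , k<eᵢ₊₁

  composite-* : ∀ d k .{{_ : ℕ.NonTrivial d}} → 1 < k → Composite (d * k)
  composite-* d k {{d-nonTrivial}} 1<k = composite-≢ d {{d-nonTrivial}} {{ℕₚ.m*n≢0 d k}} (ℕₚ.<⇒≢ (ℕₚ.m<m*n d k 1<k)) (m∣m*n k)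
    where
    instance
      _ : NonZero d
      _ = ℕ.nonTrivial⇒nonZero d
      _ : NonZero k
      _ = ℕ.>-nonZero (ℕₚ.<-trans z<s 1<k)

  T-does⁻ : ∀ {A : Set} (a? : Dec A) → T (does a?) → A
  T-does⁻ (yes a) _ = a

  T-does⁺ : ∀ {A : Set} (a? : Dec A) → A → T (does a?)
  T-does⁺ (yes _) _ = _
  T-does⁺ (no ¬a) a = ¬a a

  isPrimePowerᵇ-sound : ∀ d → T (isPrimePowerᵇ d) → ∃₂ λ q k → Prime q × q ^ suc k ≡ d
  isPrimePowerᵇ-sound d isPP
    with q , q-witness ← satisfied (any⁻ _ (upTo (suc d)) isPP)
    with q-prime , has-k ← Equivalence.to T-∧ q-witness
    with k , qᵏ⁺¹≡ᵇd ← satisfied (any⁻ _ (upTo d) has-k)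
    = q , k , T-does⁻ (prime? q) q-prime , ℕₚ.≡ᵇ⇒≡ _ d qᵏ⁺¹≡ᵇd

  isPrimePowerᵇ-complete : ∀ {q} → Prime q → ∀ k → T (isPrimePowerᵇ (q ^ suc k))
  isPrimePowerᵇ-complete {q} q-prime k =
    any⁺ (λ p → does (prime? p) ∧ any (λ j → p ^ suc j ℕ.≡ᵇ d) (upTo d)) (lose (∈-upTo⁺ q<1+d)
      (Equivalence.from T-∧ (T-does⁺ (prime? q) q-prime ,
                             any⁺ (λ j → q ^ suc j ℕ.≡ᵇ d) (lose (∈-upTo⁺ k<d) (ℕₚ.≡⇒≡ᵇ d d refl)))))
    where
    d = q ^ suc k
    q<1+d : q < suc d
    q<1+d = s≤s (ℕₚ.m≤m*n q (q ^ k) {{ℕₚ.m^n≢0 q k {{prime⇒nonZero q-prime}}}})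
    k<d : k < d
    k<d = ℕₚ.<-trans (ℕₚ.n<1+n k) (n<m^n (prime⇒1< q-prime) (suc k))

module GiugaSum where

  open import Data.Bool using (Bool; T; _∧_)
  open import Data.Bool.Properties using (T-∧)
  open import Data.List using (foldr)
  open import Data.List.Properties using (map-upTo)
  open import Data.Nat as ℕ using (ℕ; suc; NonZero; _<_; _≤_)
  open import Data.Nat.Divisibility using (_∣_; _∣?_; ∣-trans; m∣m*n; ∣⇒≤)
  open import Data.Nat.Primality using (Prime; prime⇒nonZero)
  import Data.Nat.Properties as ℕₚ
  open import Data.Product using (_×_; _,_; ∃₂)
  open import Data.Rational using (ℚ; 0ℚ; 1ℚ; _+_; _-_)
  open import Data.Rational.Properties using (+-identityʳ)
  open import Function using (_∘_)
  open import Function.Bundles using (Equivalence)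
  open import Relation.Binary.PropositionalEquality
    using (_≡_; refl; sym; trans; cong; cong₂; subst; subst₂; module ≡-Reasoning)
  open import Relation.Nullary using (does)
  open import Defs using (recip; isPrimePowerᵇ; primePowerRecipSum)
  open Sums
  open PrimePowers

  primePowerRecipSum-∏ : ∀ n .{{_ : NonZero n}} L {p e : ℕ → ℕ} →
    (∀ {i} → i < L → Prime (p i)) → (∀ {i j} → i < L → j < L → p i ≡ p j → i ≡ j) →
    n ≡ ∏ L (λ i → p i ℕ.^ e i) →
    primePowerRecipSum n ≡ ∑ L (λ i → ∑ (e i) (λ k → recip (p i ℕ.^ suc k)))
  primePowerRecipSum-∏ n L {p} {e} p-prime p-inj n≡∏ =
    trans (cong (foldr _+_ 0ℚ) (map-upTo _ n))
          (∑-reindex L e (λ i k → p i ℕ.^ suc k) c v-injective v-satisfies v-surjective recip n v-range)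
    where
    c : ℕ → Bool
    c d = isPrimePowerᵇ d ∧ does (d ∣? n)

    v∣n : ∀ {i k} → i < L → k < e i → p i ℕ.^ suc k ∣ n
    v∣n {i} {k} i<L k<e = subst (p i ℕ.^ suc k ∣_) (sym n≡∏)
      (∣-trans (^-monoʳ-∣ (p i) k<e) (f∣∏ (λ i → p i ℕ.^ e i) i<L))

    same-base : ∀ {i k i′ k′} → i < L → i′ < L → p i ℕ.^ suc k ≡ p i′ ℕ.^ suc k′ → p i ≡ p i′
    same-base {i} {k} {k′ = k′} i<L i′<L eq = prime∣prime⇒≡ (p-prime i<L) (p-prime i′<L)
      (prime∣^⇒∣ (p-prime i<L) (suc k′) (subst (p i ∣_) eq (m∣m*n (p i ℕ.^ k))))

    v-injective : ∀ {i k i′ k′} → i < L → k < e i → i′ < L → k′ < e i′ →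
                  p i ℕ.^ suc k ≡ p i′ ℕ.^ suc k′ → i ≡ i′ × k ≡ k′
    v-injective {k = k} {k′ = k′} i<L _ i′<L _ eq with refl ← p-inj i<L i′<L (same-base {k = k} {k′ = k′} i<L i′<L eq)
      = refl , ℕₚ.suc-injective (^-injectiveʳ (prime⇒1< (p-prime i<L)) eq)

    v-satisfies : ∀ {i k} → i < L → k < e i → T (c (p i ℕ.^ suc k))
    v-satisfies {i} {k} i<L k<e = Equivalence.from T-∧
      (isPrimePowerᵇ-complete (p-prime i<L) k , T-does⁺ (p i ℕ.^ suc k ∣? n) (v∣n i<L k<e))

    v-surjective : ∀ d → T (c d) → ∃₂ λ i k → i < L × k < e i × p i ℕ.^ suc k ≡ d
    v-surjective d cd
      with isPP , d∣n ← Equivalence.to T-∧ cd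
      with q , k , q-prime , qᵏ⁺¹≡d ← isPrimePowerᵇ-sound d isPP
      with i , i<L , refl , k<e ← prime^∣∏^⇒factor L p-prime p-inj q-prime
             (subst₂ _∣_ (sym qᵏ⁺¹≡d) n≡∏ (T-does⁻ (d ∣? n) d∣n))
      = i , k , i<L , k<e , qᵏ⁺¹≡d

    v-range : ∀ {i k} → i < L → k < e i → 0 < p i ℕ.^ suc k × p i ℕ.^ suc k ≤ n
    v-range {i} {k} i<L k<e = ℕₚ.m^n>0 (p i) {{prime⇒nonZero (p-prime i<L)}} (suc k) , ∣⇒≤ (v∣n i<L k<e)

  ∑-chain : ∀ m (p a : ℕ → ℕ) → (∀ {i} → i < m → p i ≡ suc (∏ i (λ j → p j ℕ.^ a j))) →
            ∑ m (λ i → ∑ (a i) (λ k → recip (p i ℕ.^ suc k))) ≡ 1ℚ - recip (∏ m (λ j → p j ℕ.^ a j))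
  ∑-chain m p a pᵢ≡1+Qᵢ = trans (∑-cong m geometric-block) (∑-telescope m (recip ∘ Q))
    where
    w : ℕ → ℕ
    w j = p j ℕ.^ a j
    Q : ℕ → ℕ
    Q i = ∏ i w

    Q-nonZero : ∀ {i} → i < m → NonZero (Q i)
    Q-nonZero i<m = ∏-nonZero _ λ {j} j<i →
      ℕₚ.m^n≢0 (p j) (a j) {{subst NonZero (sym (pᵢ≡1+Qᵢ (ℕₚ.<-trans j<i i<m))) _}}

    geometric-block : ∀ {i} → i < m → ∑ (a i) (λ k → recip (p i ℕ.^ suc k)) ≡ recip (Q i) - recip (Q (suc i))
    geometric-block {i} i<m = begin
      ∑ (a i) (λ k → recip (p i ℕ.^ suc k))
        ≡⟨ cong (λ x → ∑ (a i) (λ k → recip (x ℕ.^ suc k))) (pᵢ≡1+Qᵢ i<m) ⟩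
      ∑ (a i) (λ k → recip (suc (Q i) ℕ.^ suc k))
        ≡⟨ ∑-geometric (Q i) {{Q-nonZero i<m}} (a i) ⟩
      recip (Q i) - recip (Q i ℕ.* suc (Q i) ℕ.^ a i)
        ≡⟨ cong (λ x → recip (Q i) - recip (Q i ℕ.* x ℕ.^ a i)) (pᵢ≡1+Qᵢ i<m) ⟨
      recip (Q i) - recip (Q i ℕ.* w i)
        ≡⟨ cong (λ x → recip (Q i) - recip x) (∏-snoc i w) ⟨
      recip (Q i) - recip (Q (suc i))
        ∎
      where open ≡-Reasoning

  primePowerRecipSum-recip≡1 : ∀ n .{{_ : NonZero n}} m (p a : ℕ → ℕ) →
    (∀ {i} → i < suc m → Prime (p i)) → (∀ {i j} → i < suc m → j < suc m → p i ≡ p j → i ≡ j) →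
    n ≡ ∏ (suc m) (λ j → p j ℕ.^ a j) →
    (∀ {i} → i < m → p i ≡ suc (∏ i (λ j → p j ℕ.^ a j))) →
    a m ≡ 1 → p m ℕ.* (p m ℕ.+ 1) ≡ n →
    primePowerRecipSum n - recip n ≡ 1ℚ
  primePowerRecipSum-recip≡1 n m p a p-prime p-inj n≡∏ pᵢ≡1+Qᵢ aₘ≡1 pₘ[pₘ+1]≡n = begin
    primePowerRecipSum n - recip n
      ≡⟨ cong₂ _-_ (primePowerRecipSum-∏ n (suc m) {p} {a} p-prime p-inj n≡∏) (cong recip n≡Qₘpₘ) ⟩
    ∑ (suc m) G - recip (Qₘ ℕ.* p m)
      ≡⟨ cong (_- recip (Qₘ ℕ.* p m)) (∑-snoc m G) ⟩
    ∑ m G + G m - recip (Qₘ ℕ.* p m)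
      ≡⟨ cong₂ (λ u v → u + v - recip (Qₘ ℕ.* p m)) (∑-chain m p a pᵢ≡1+Qᵢ) Gₘ≡recip[pₘ] ⟩
    1ℚ - recip Qₘ + recip (p m) - recip (Qₘ ℕ.* p m)
      ≡⟨ cong (λ x → 1ℚ - recip x + recip (p m) - recip (x ℕ.* p m)) Qₘ≡1+pₘ ⟩
    1ℚ - recip (suc (p m)) + recip (p m) - recip (suc (p m) ℕ.* p m)
      ≡⟨ giuga-identity (p m) ⟩
    1ℚ
      ∎
    where
    open ≡-Reasoning
    instance
      _ : NonZero (p m)
      _ = prime⇒nonZero (p-prime (ℕₚ.n<1+n m))
    w : ℕ → ℕ
    w j = p j ℕ.^ a j
    Qₘ : ℕ
    Qₘ = ∏ m w
    G : ℕ → ℚ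
    G i = ∑ (a i) (λ k → recip (p i ℕ.^ suc k))

    n≡Qₘpₘ : n ≡ Qₘ ℕ.* p m
    n≡Qₘpₘ = trans n≡∏ (trans (∏-snoc m w) (cong (Qₘ ℕ.*_) (trans (cong (p m ℕ.^_) aₘ≡1) (ℕₚ.*-identityʳ (p m)))))

    Qₘ≡1+pₘ : Qₘ ≡ suc (p m)
    Qₘ≡1+pₘ = ℕₚ.*-cancelˡ-≡ Qₘ (suc (p m)) (p m) (begin
      p m ℕ.* Qₘ             ≡⟨ ℕₚ.*-comm (p m) Qₘ ⟩
      Qₘ ℕ.* p m             ≡⟨ trans (sym n≡Qₘpₘ) (sym pₘ[pₘ+1]≡n) ⟩
      p m ℕ.* (p m ℕ.+ 1)     ≡⟨ cong (p m ℕ.*_) (ℕₚ.+-comm (p m) 1) ⟩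
      p m ℕ.* suc (p m)       ∎)

    Gₘ≡recip[pₘ] : G m ≡ recip (p m)
    Gₘ≡recip[pₘ] = begin
      ∑ (a m) (λ k → recip (p m ℕ.^ suc k)) ≡⟨ cong (λ e → ∑ e (λ k → recip (p m ℕ.^ suc k))) aₘ≡1 ⟩
      recip (p m ℕ.^ 1) + 0ℚ                ≡⟨ +-identityʳ (recip (p m ℕ.^ 1)) ⟩
      recip (p m ℕ.^ 1)                     ≡⟨ cong recip (ℕₚ.*-identityʳ (p m)) ⟩
      recip (p m)                           ∎

open import Defs
open import Data.Nat using (ℕ; suc; _+_; _*_; _∸_; _^_; _<_; _≤_)
open import Data.Nat.Primality using (Prime; Composite; composite⇒nonZero; prime⇒nonTrivial)
open import Data.List using (map; upTo)
open import Data.Nat.ListAction using (product)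
open import Relation.Binary.PropositionalEquality using (_≡_; sym; trans; cong; subst)
import Data.Nat.Properties as ℕₚ
open import Data.List.Properties using (map-upTo)
open import Data.Product using (_,_)
open PrimePowers using (∏; prime⇒1<; increasing⇒injective; composite-*)
open GiugaSum using (primePowerRecipSum-recip≡1)

lemma4 : (n m : ℕ) (p a : ℕ → ℕ)
    → 1 < n
    → (∀ i → i ≤ m → Prime (p i))
    → (∀ i j → j ≤ m → i < j → p i < p j)
    → (∀ i → i ≤ m → 1 ≤ a i)
    → a m ≡ 1
    → n ≡ product (map (λ j → p j ^ a j) (upTo (suc m)))
    → (∀ i → i < m → p i ∸ 1 ≡ product (map (λ j → p j ^ a j) (upTo i)))
    → p m * (p m + 1) ≡ n
    → PrimePowerGiuga n
lemma4 n m p a _ p-prime p-increasing _ aₘ≡1 n≡∏ pᵢ∸1≡∏ pₘ[pₘ+1]≡n =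
  n-composite , 1 ,
  primePowerRecipSum-recip≡1 n {{composite⇒nonZero n-composite}} m p a
    (λ i<1+m → p-prime _ (ℕₚ.≤-pred i<1+m))
    (increasing⇒injective (suc m) λ j<1+m → p-increasing _ _ (ℕₚ.≤-pred j<1+m))
    (trans n≡∏ (cong product (map-upTo w (suc m))))
    pᵢ≡1+∏ aₘ≡1 pₘ[pₘ+1]≡n
  where
  w : ℕ → ℕ
  w j = p j ^ a j

  pₘ-prime : Prime (p m)
  pₘ-prime = p-prime m ℕₚ.≤-refl

  n-composite : Composite n
  n-composite = subst Composite pₘ[pₘ+1]≡n
    (composite-* (p m) (p m + 1) {{prime⇒nonTrivial pₘ-prime}} (ℕₚ.m<n+m 1 (ℕₚ.<-trans (ℕₚ.n<1+n 0) (prime⇒1< pₘ-prime))))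

  pᵢ≡1+∏ : ∀ {i} → i < m → p i ≡ suc (∏ i w)
  pᵢ≡1+∏ {i} i<m = trans (sym (ℕₚ.m+[n∸m]≡n 1≤pᵢ)) (cong suc (trans (pᵢ∸1≡∏ i i<m) (cong product (map-upTo w i))))
    where
    1≤pᵢ : 1 ≤ p i
    1≤pᵢ = ℕₚ.<⇒≤ (prime⇒1< (p-prime i (ℕₚ.<⇒≤ i<m)))
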